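{- Let $G$ be a cograph. Then every clique partition $\mathcal{X}$ of $G$ that can be output by the algorithm \textsc{Greedy} on input $G$ is maximal under the relation $\preceq$ among all clique partitions of $G$; that is, there is no clique partition $\mathcal{Y}$ of $G$ with $\mathcal{X}\preceq\mathcal{Y}$ and $\mathcal{Y}\not\preceq\mathcal{X}$.
   Context: All graphs are finite, simple, undirected. A cograph is a graph with no induced subgraph isomorphic to the 4-vertex path $P_4$. A clique partition of $G$ is a partition of $V(G)$ into cliques (sets of pairwise adjacent vertices). The algorithm \textsc{Greedy} on input $G$: set $\mathcal{X}=\emptyset$; while $G$ has a vertex, choose any maximum-size clique $X$ of $G$, add $X$ to $\mathcal{X}$, and replace $G$ by $G-X$; output $\mathcal{X}$. For clique partitions $\mathcal{X}=\{X_1,\dots,X_s\}$ and $\mathcal{Y}=\{Y_1,\dots,Y_t\}$ of $G$ indexed so that $|X_1|\geq\dots\geq|X_s|$ and $|Y_1|\geq\dots\geq|Y_t|$ (and with $|X_i|=0$ for $i>s$, $|Y_i|=0$ for $i>t$), write $\mathcal{X}\preceq\mathcal{Y}$ if $\sum_{i=1}^{j}|X_i|\leq\sum_{i=1}^{j}|Y_i|$ for all $1\leq j\leq\max\{s,t\}$. -}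

module Defs where

open import Data.Nat using (ℕ; _≤_)
open import Data.Nat.Properties using (≤-decTotalOrder)
open import Data.Fin using (Fin)
open import Data.Fin.Subset using (Subset; _∈_; _∉_; ⊤; ⊥; ⁅_⁆; _∪_; _─_; Nonempty; Empty)
open import Data.List using (List; []; _∷_; length; map; reverse; take; concat; allFin; foldr)
open import Data.Nat.ListAction using (sum)
open import Data.Empty using () renaming (⊥ to False)
open import Data.Unit using () renaming (⊤ to True)
open import Data.List.Relation.Unary.All using (All)
open import Data.List.Relation.Unary.AllPairs using (AllPairs)
open import Data.List.Relation.Unary.Any using (Any)
open import Data.List.Relation.Binary.Permutation.Propositional using (_↭_)
open import Data.Product using (_×_; Σ)
open import Relation.Nullary using (¬_; Dec)
open import Relation.Binary.PropositionalEquality using (_≡_)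
import Data.List.Sort

record Graph : Set₁ where
  field
    n     : ℕ
    Adj   : Fin n → Fin n → Set
    adj?  : ∀ u v → Dec (Adj u v)
    sym   : ∀ {u v} → Adj u v → Adj v u
    irrefl : ∀ {u} → ¬ Adj u u
open Graph public

-- Cograph: no induced P4 a - b - c - d (distinctness of a,b,c,d is
-- forced by the edges/non-edges and irreflexivity).
Cograph : Graph → Set
Cograph G = ∀ (a b c d : Fin (n G)) →
  ¬ ( Adj G a b × Adj G b c × Adj G c d ×
      ¬ Adj G a c × ¬ Adj G b d × ¬ Adj G a d )

-- A clique given as a list of pairwise adjacent vertices
-- (hence pairwise distinct, by irreflexivity).
IsClique : (G : Graph) → List (Fin (n G)) → Set
IsClique G X = AllPairs (Adj G) X

NonEmptyList : ∀ {A : Set} → List A → Set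
NonEmptyList [] = False
NonEmptyList (_ ∷ _) = True

-- A clique partition: a list of nonempty cliques whose concatenation
-- is a permutation of the vertex list (so every vertex lies in exactly
-- one block, exactly once).
IsCliquePartition : (G : Graph) → List (List (Fin (n G))) → Set
IsCliquePartition G 𝒳 =
  All (λ X → NonEmptyList X × IsClique G X) 𝒳 × (concat 𝒳 ↭ allFin (n G))

listToSubset : ∀ {m} → List (Fin m) → Subset m
listToSubset = foldr (λ v s → ⁅ v ⁆ ∪ s) ⊥

-- Runs of Greedy on the induced subgraph G[S]: GreedyRun G S 𝒳 means
-- that 𝒳 (in order of selection) can be output by Greedy started on G[S].
data GreedyRun (G : Graph) : Subset (n G) → List (List (Fin (n G))) → Set where
  stop : ∀ {S} → Empty S → GreedyRun G S []
  step : ∀ {S X 𝒳} →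
         Nonempty S →
         IsClique G X → All (_∈ S) X →
         (∀ Y → IsClique G Y → All (_∈ S) Y → length Y ≤ length X) →
         GreedyRun G (S ─ listToSubset X) 𝒳 →
         GreedyRun G S (X ∷ 𝒳)

GreedyOutput : (G : Graph) → List (List (Fin (n G))) → Set
GreedyOutput G 𝒳 = GreedyRun G ⊤ 𝒳

open Data.List.Sort ≤-decTotalOrder using (sort)

sortedSizes : ∀ {A : Set} → List (List A) → List ℕ
sortedSizes 𝒳 = reverse (sort (map length 𝒳))

-- 𝒳 ≼ 𝒴 : prefix sums of sorted block sizes are dominated
-- (take beyond the length pads with zeros implicitly).
_≼_ : ∀ {A : Set} → List (List A) → List (List A) → Set
𝒳 ≼ 𝒴 = ∀ (j : ℕ) → sum (take j (sortedSizes 𝒳)) ≤ sum (take j (sortedSizes 𝒴))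

-- Let C be a maximum clique of G[S]. Exchange lemma: k + 1 disjoint cliques of G[S] can be
-- traded for C together with at most k disjoint cliques of G[S] − C, covering at least as many
-- vertices. It is proved by induction on |S|, using that a cograph on two or more vertices splits
-- into nonempty parts A, B that are either completely joined or not joined at all. In the joined
-- case C and every clique split along A and B, and the two inductive answers are merged blockwise;
-- otherwise C lies on one side, say A, every clique lies within A or within B, and the cliques in
-- B are kept while those in A are exchanged inductively (if there are none in A, one clique of B,
-- being no larger than C, is dropped instead). Along a Greedy run this shows that any
-- j disjoint cliques cover at most as many vertices as the first j greedy cliques. Applied to the
-- j largest blocks of a clique partition 𝒴 this gives 𝒴 ≼ 𝒳 for every Greedy output 𝒳.

module Submission where

open import Defs
open import Level using (0ℓ)
open import Data.Nat using (ℕ; zero; suc; _+_; _≤_; _≥_; z≤n; s≤s; _⊔_)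
open import Data.Nat.Properties
open import Data.Nat.ListAction using (sum)
open import Algebra.Properties.CommutativeSemigroup +-commutativeSemigroup using (interchange)
open import Data.Fin as Fin using (Fin)
open import Data.Fin.Subset using (Subset; ⊤; ⁅_⁆; _─_; Empty) renaming (_∈_ to _∈ₛ_)
open import Data.Fin.Subset.Properties using (∉⊥; x∈p∪q⁻; x∈⁅y⁆⇒x≡y; x∈p∧x∉q⇒x∈p─q; ∈⊤)
  renaming (_∈?_ to _∈ₛ?_)
open import Data.List using (List; []; _∷_; _++_; length; map; reverse; take; concat; filter; allFin)
open import Data.List.Properties using (length-++; length-map; concat-++; filter-++; unfold-reverse)
  renaming (++-identityʳ to ++-identityʳ-≡)
open import Data.List.Relation.Unary.All as All using (All; []; _∷_)
import Data.List.Relation.Unary.All.Properties as All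
open import Data.List.Relation.Unary.AllPairs as AllPairs using (AllPairs; []; _∷_)
import Data.List.Relation.Unary.AllPairs.Properties as AllPairs
open import Data.List.Relation.Unary.Any using (here; there; any?)
open import Data.List.Relation.Unary.All.Properties.Core using (¬All⇒Any¬)
open import Data.List.Relation.Unary.Linked.Properties using (Linked⇒AllPairs)
open import Data.List.Relation.Unary.Unique.Propositional using (Unique)
import Data.List.Relation.Unary.Unique.Propositional.Properties as Unique
open import Data.List.Relation.Binary.Disjoint.Propositional using (Disjoint)
open import Data.List.Membership.Propositional using (_∈_; _∉_; find; lose)
open import Data.List.Membership.Propositional.Properties
  using (∈-++⁺ˡ; ∈-++⁺ʳ; ∈-++⁻; ∈-filter⁺; ∈-filter⁻; ∈-allFin)
open import Data.List.Relation.Binary.Permutation.Propositional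
open import Data.List.Relation.Binary.Permutation.Propositional.Properties
  using ( ↭-length; ∈-resp-↭; ++⁺ˡ; ++⁺ʳ; shift; shifts; ++-comm; ++-assoc; ++-identityʳ
        ; All-resp-↭; ↭-reverse)
import Data.List.Relation.Binary.Permutation.Setoid.Properties as ↭ₛ
open import Data.List.Sort ≤-decTotalOrder using (sort-↭; sort-↗)
open import Data.Product using (Σ; _×_; _,_; proj₁; proj₂)
open import Data.Sum using (_⊎_; inj₁; inj₂)
open import Data.Empty using (⊥; ⊥-elim)
open import Relation.Nullary using (¬_; ¬?; yes; no)
open import Relation.Nullary.Decidable using (decidable-stable)
open import Relation.Unary using (Pred; Decidable)
open import Relation.Unary.Properties using (∁?)
open import Relation.Binary using (Rel; Symmetric; DecidableEquality) renaming (Decidable to Decidable₂)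
open import Relation.Binary.PropositionalEquality as ≡
  using (_≡_; refl; cong; cong₂; subst; module ≡-Reasoning)

private variable
  A : Set
  xs ys : List A
  xss yss : List (List A)

length-concat : (xss : List (List A)) → length (concat xss) ≡ sum (map length xss)
length-concat []         = refl
length-concat (xs ∷ xss) = ≡.trans (length-++ xs) (cong (length xs +_) (length-concat xss))

concat-↭ : xss ↭ yss → concat xss ↭ concat yss
concat-↭ refl          = refl
concat-↭ (prep xs p)   = ++⁺ˡ xs (concat-↭ p)
concat-↭ (swap xs ys p) = trans (shifts xs ys) (++⁺ˡ ys (++⁺ˡ xs (concat-↭ p)))
concat-↭ (trans p q)   = trans (concat-↭ p) (concat-↭ q)

module _ {P : Pred A 0ℓ} (P? : Decidable P) where

  filter-partition-↭ : (xs : List A) → xs ↭ filter P? xs ++ filter (∁? P?) xs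
  filter-partition-↭ []       = refl
  filter-partition-↭ (x ∷ xs) with P? x
  ... | yes _ = prep x (filter-partition-↭ xs)
  ... | no  _ = trans (prep x (filter-partition-↭ xs)) (↭-sym (shift x (filter P? xs) _))

  length-filter-partition : (xs : List A) → length xs ≡ length (filter P? xs) + length (filter (∁? P?) xs)
  length-filter-partition xs = ≡.trans (↭-length (filter-partition-↭ xs)) (length-++ (filter P? xs))

  concat-map-filter : (xss : List (List A)) → concat (map (filter P?) xss) ≡ filter P? (concat xss)
  concat-map-filter []         = refl
  concat-map-filter (xs ∷ xss) =
    ≡.trans (cong (filter P? xs ++_) (concat-map-filter xss)) (≡.sym (filter-++ P? xs (concat xss)))

Unique-resp-↭ : xs ↭ ys → Unique xs → Unique ys
Unique-resp-↭ p = ↭ₛ.Unique-resp-↭ (≡.setoid _) (↭⇒↭ₛ p)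

module _ {R : Rel A 0ℓ} where

  AllPairs-++⁻ˡ : ∀ xs → AllPairs R (xs ++ ys) → AllPairs R xs
  AllPairs-++⁻ˡ []       _          = []
  AllPairs-++⁻ˡ (x ∷ xs) (px ∷ pxs) = All.++⁻ˡ xs px ∷ AllPairs-++⁻ˡ xs pxs

  AllPairs-++⁻ʳ : ∀ xs → AllPairs R (xs ++ ys) → AllPairs R ys
  AllPairs-++⁻ʳ []       pxs       = pxs
  AllPairs-++⁻ʳ (x ∷ xs) (_ ∷ pxs) = AllPairs-++⁻ʳ xs pxs

  AllPairs-reverse : AllPairs R xs → AllPairs (λ a b → R b a) (reverse xs)
  AllPairs-reverse {xs = []}     []         = []
  AllPairs-reverse {xs = x ∷ xs} (px ∷ pxs) rewrite unfold-reverse x xs =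
    AllPairs.++⁺ (AllPairs-reverse pxs) ([] ∷ [])
      (All.map (_∷ []) (All-resp-↭ (↭-sym (↭-reverse xs)) px))

  AllPairs-∈ : Symmetric R → AllPairs R xs → ∀ {x y} → x ∈ xs → y ∈ xs → x ≡ y ⊎ R x y
  AllPairs-∈ sym (px ∷ pxs) (here refl) (here refl) = inj₁ refl
  AllPairs-∈ sym (px ∷ pxs) (here refl) (there y∈) = inj₂ (All.lookup px y∈)
  AllPairs-∈ sym (px ∷ pxs) (there x∈) (here refl) = inj₂ (sym (All.lookup px x∈))
  AllPairs-∈ sym (px ∷ pxs) (there x∈) (there y∈) = AllPairs-∈ sym pxs x∈ y∈

Unique-++⇒Disjoint : ∀ (xs : List A) → Unique (xs ++ ys) → Disjoint xs ys
Unique-++⇒Disjoint (x ∷ xs) (x∉ ∷ _) (here refl , y∈) = All.lookup x∉ (∈-++⁺ʳ xs y∈) refl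
Unique-++⇒Disjoint (x ∷ xs) (_ ∷ u)  (there x∈ , y∈) = Unique-++⇒Disjoint xs u (x∈ , y∈)

length-Unique-≤1 : ∀ {S xs : List A} → length S ≤ 1 → Unique xs → All (_∈ S) xs → length xs ≤ length S
length-Unique-≤1 {S = []}      {[]}        _ _ _ = z≤n
length-Unique-≤1 {S = []}      {_ ∷ _}     _ _ (() ∷ _)
length-Unique-≤1 {S = _ ∷ []}  {[]}        _ _ _ = z≤n
length-Unique-≤1 {S = _ ∷ []}  {_ ∷ []}    _ _ _ = ≤-refl
length-Unique-≤1 {S = _ ∷ []}  {_ ∷ _ ∷ _} _ ((x≢y ∷ _) ∷ _) (here refl ∷ here refl ∷ _) =
  ⊥-elim (x≢y refl)
length-Unique-≤1 {S = _ ∷ _ ∷ _} (s≤s ())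

∈⇒1≤length : ∀ {x : A} {xs} → x ∈ xs → 1 ≤ length xs
∈⇒1≤length (here _)  = s≤s z≤n
∈⇒1≤length (there _) = s≤s z≤n

split-smaller : ∀ {zs : List A} xs ys {m} → zs ↭ xs ++ ys → length zs ≤ suc m → 1 ≤ length ys →
                length xs ≤ m
split-smaller {zs = zs} xs ys {m} p lzs nys = ≤-pred (begin
  suc (length xs)        ≡⟨ +-comm 1 (length xs) ⟩
  length xs + 1          ≤⟨ +-monoʳ-≤ (length xs) nys ⟩
  length xs + length ys  ≡⟨ length-++ xs ⟨
  length (xs ++ ys)      ≡⟨ ↭-length p ⟨
  length zs              ≤⟨ lzs ⟩
  suc m                  ∎)
  where open ≤-Reasoning

zip++ : List (List A) → List (List A) → List (List A)
zip++ []         yss        = yss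
zip++ (xs ∷ xss) []         = xs ∷ xss
zip++ (xs ∷ xss) (ys ∷ yss) = (xs ++ ys) ∷ zip++ xss yss

length-zip++ : ∀ {k} (xss yss : List (List A)) → length xss ≤ k → length yss ≤ k →
               length (zip++ xss yss) ≤ k
length-zip++ []        _         _       q       = q
length-zip++ (_ ∷ _)   []        p       _       = p
length-zip++ (_ ∷ xss) (_ ∷ yss) (s≤s p) (s≤s q) = s≤s (length-zip++ xss yss p q)

concat-zip++ : (xss yss : List (List A)) → concat (zip++ xss yss) ↭ concat xss ++ concat yss
concat-zip++ []         yss        = refl
concat-zip++ (xs ∷ xss) []         = ↭-sym (++-identityʳ _)
concat-zip++ (xs ∷ xss) (ys ∷ yss) = begin
  (xs ++ ys) ++ concat (zip++ xss yss)      ↭⟨ ++-assoc xs ys _ ⟩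
  xs ++ ys ++ concat (zip++ xss yss)        ↭⟨ ++⁺ˡ xs (++⁺ˡ ys (concat-zip++ xss yss)) ⟩
  xs ++ ys ++ concat xss ++ concat yss      ↭⟨ ++⁺ˡ xs (shifts ys (concat xss)) ⟩
  xs ++ concat xss ++ ys ++ concat yss      ↭⟨ ↭-sym (++-assoc xs (concat xss) _) ⟩
  (xs ++ concat xss) ++ ys ++ concat yss    ∎
  where open PermutationReasoning

module _ {P Q T : Pred (List A) 0ℓ} (combine : ∀ {xs ys} → P xs → Q ys → T (xs ++ ys))
         (P[] : P []) (Q[] : Q []) where

  All-zip++ : All P xss → All Q yss → All T (zip++ xss yss)
  All-zip++ []         qs         = All.map (combine P[]) qs
  All-zip++ (p ∷ ps)   []         =
    All.map (λ {xs} px → subst T (++-identityʳ-≡ xs) (combine px Q[])) (p ∷ ps)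
  All-zip++ (p ∷ ps)   (q ∷ qs)   = combine p q ∷ All-zip++ ps qs

-- Prefix sums of block sizes

-- topSum j L is the largest total of at most j entries of L.
topSum : ℕ → List ℕ → ℕ
topSum zero    _       = 0
topSum (suc j) []      = 0
topSum (suc j) (x ∷ L) = (x + topSum j L) ⊔ topSum (suc j) L

sum-take-mono : ∀ {i j} → i ≤ j → ∀ L → sum (take i L) ≤ sum (take j L)
sum-take-mono z≤n     L       = z≤n
sum-take-mono (s≤s p) []      = z≤n
sum-take-mono (s≤s p) (x ∷ L) = +-monoʳ-≤ x (sum-take-mono p L)

sum-take≤topSum : ∀ j L → sum (take j L) ≤ topSum j L
sum-take≤topSum zero    L       = z≤n
sum-take≤topSum (suc j) []      = z≤n
sum-take≤topSum (suc j) (x ∷ L) = ≤-trans (+-monoʳ-≤ x (sum-take≤topSum j L)) (m≤m⊔n _ _)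

topSum-∷ : ∀ j x L → topSum j L ≤ topSum j (x ∷ L)
topSum-∷ zero    x L = z≤n
topSum-∷ (suc j) x L = m≤n⊔m _ _

topSum-swap : ∀ j x y L → topSum j (x ∷ y ∷ L) ≡ topSum j (y ∷ x ∷ L)
topSum-swap zero          x y L = refl
topSum-swap (suc zero)    x y L = begin
  (x + 0) ⊔ ((y + 0) ⊔ b)   ≡⟨ ⊔-assoc (x + 0) (y + 0) b ⟨
  ((x + 0) ⊔ (y + 0)) ⊔ b   ≡⟨ cong (_⊔ b) (⊔-comm (x + 0) (y + 0)) ⟩
  ((y + 0) ⊔ (x + 0)) ⊔ b   ≡⟨ ⊔-assoc (y + 0) (x + 0) b ⟩
  (y + 0) ⊔ ((x + 0) ⊔ b)   ∎
  where open ≡-Reasoning; b = topSum 1 L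
topSum-swap (suc (suc j)) x y L = begin
  (x + ((y + a) ⊔ b)) ⊔ ((y + b) ⊔ c)     ≡⟨ spread x y ⟩
  (x + y + a) ⊔ ((x + b) ⊔ (y + b)) ⊔ c   ≡⟨ cong₂ (λ u v → u ⊔ v ⊔ c)
                                               (cong (_+ a) (+-comm x y)) (⊔-comm (x + b) (y + b)) ⟩
  (y + x + a) ⊔ ((y + b) ⊔ (x + b)) ⊔ c   ≡⟨ spread y x ⟨
  (y + ((x + a) ⊔ b)) ⊔ ((x + b) ⊔ c)     ∎
  where
  open ≡-Reasoning
  a = topSum j L
  b = topSum (suc j) L
  c = topSum (suc (suc j)) L
  spread : ∀ x y → (x + ((y + a) ⊔ b)) ⊔ ((y + b) ⊔ c) ≡ (x + y + a) ⊔ ((x + b) ⊔ (y + b)) ⊔ c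
  spread x y = begin
    (x + ((y + a) ⊔ b)) ⊔ ((y + b) ⊔ c)         ≡⟨ cong (_⊔ ((y + b) ⊔ c)) (+-distribˡ-⊔ x (y + a) b) ⟩
    ((x + (y + a)) ⊔ (x + b)) ⊔ ((y + b) ⊔ c)   ≡⟨ ⊔-assoc (x + (y + a)) (x + b) _ ⟩
    (x + (y + a)) ⊔ ((x + b) ⊔ ((y + b) ⊔ c))   ≡⟨ cong₂ _⊔_ (+-assoc x y a) (⊔-assoc (x + b) (y + b) c) ⟨
    (x + y + a) ⊔ (((x + b) ⊔ (y + b)) ⊔ c)     ≡⟨ ⊔-assoc (x + y + a) _ c ⟨
    (x + y + a) ⊔ ((x + b) ⊔ (y + b)) ⊔ c       ∎

topSum-∷-cong : ∀ {L L′} → (∀ j → topSum j L ≡ topSum j L′) →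
                ∀ x j → topSum j (x ∷ L) ≡ topSum j (x ∷ L′)
topSum-∷-cong eq x zero    = refl
topSum-∷-cong eq x (suc j) = cong₂ (λ u v → (x + u) ⊔ v) (eq j) (eq (suc j))

topSum-↭ : ∀ {L L′} → L ↭ L′ → ∀ j → topSum j L ≡ topSum j L′
topSum-↭ refl         j = refl
topSum-↭ (prep x p)   j = topSum-∷-cong (topSum-↭ p) x j
topSum-↭ (swap x y p) j =
  ≡.trans (topSum-∷-cong (topSum-∷-cong (topSum-↭ p) y) x j) (topSum-swap j x y _)
topSum-↭ (trans p q)  j = ≡.trans (topSum-↭ p j) (topSum-↭ q j)

topSum-suc : ∀ {x} L → All (_≤ x) L → ∀ j → topSum (suc j) L ≤ x + topSum j L
topSum-suc []      []         j = z≤n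
topSum-suc (y ∷ L) (y≤x ∷ ps) j = ⊔-lub
  (+-mono-≤ y≤x (topSum-∷ j y L))
  (≤-trans (topSum-suc L ps j) (+-monoʳ-≤ _ (topSum-∷ j y L)))

topSum≤sum-take : ∀ {L} → AllPairs _≥_ L → ∀ j → topSum j L ≤ sum (take j L)
topSum≤sum-take         _          zero    = z≤n
topSum≤sum-take {[]}    _          (suc j) = z≤n
topSum≤sum-take {x ∷ L} (x≥ ∷ desc) (suc j) =
  ⊔-lub (+-monoʳ-≤ x ih) (≤-trans (topSum-suc L x≥ j) (+-monoʳ-≤ x ih))
  where ih = topSum≤sum-take desc j

sum-take-sortedSizes : ∀ (xss : List (List A)) j → sum (take j (sortedSizes xss)) ≡ topSum j (map length xss)
sum-take-sortedSizes xss j = ≤-antisym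
  (≤-trans (sum-take≤topSum j _) (≤-reflexive (topSum-↭ sorted↭ j)))
  (≤-trans (≤-reflexive (≡.sym (topSum-↭ sorted↭ j))) (topSum≤sum-take descending j))
  where
  sorted↭ : sortedSizes xss ↭ map length xss
  sorted↭ = trans (↭-reverse _) (sort-↭ (map length xss))
  descending : AllPairs _≥_ (sortedSizes xss)
  descending = AllPairs-reverse (Linked⇒AllPairs ≤-trans (sort-↗ (map length xss)))

topSum-attained : ∀ j (xss : List (List A)) → Σ (List (List A)) λ yss → Σ (List (List A)) λ zss →
  xss ↭ yss ++ zss × length yss ≤ j × topSum j (map length xss) ≡ sum (map length yss)
topSum-attained zero    xss        = [] , xss , refl , z≤n , refl
topSum-attained (suc j) []         = [] , [] , refl , z≤n , refl
topSum-attained (suc j) (xs ∷ xss)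
  with ≤-total (topSum (suc j) (map length xss)) (length xs + topSum j (map length xss))
... | inj₁ ≤taken with topSum-attained j xss
...   | yss , zss , p , l , t =
  xs ∷ yss , zss , prep xs p , s≤s l , ≡.trans (m≥n⇒m⊔n≡m ≤taken) (cong (length xs +_) t)
topSum-attained (suc j) (xs ∷ xss) | inj₂ ≤skipped with topSum-attained (suc j) xss
...   | yss , zss , p , l , t =
  yss , xs ∷ zss , trans (prep xs p) (↭-sym (shift xs yss zss)) , l , ≡.trans (m≤n⇒m⊔n≡n ≤skipped) t

-- Splitting cographs

module _ {V : Set} where

  P4Free : Rel V 0ℓ → Set
  P4Free R = ∀ a b c d → ¬ (R a b × R b c × R c d × ¬ R a c × ¬ R b d × ¬ R a d)

  Complete : Rel V 0ℓ → List V → List V → Set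
  Complete R A B = ∀ {a b} → a ∈ A → b ∈ B → R a b

  Anticomplete : Rel V 0ℓ → List V → List V → Set
  Anticomplete R = Complete (λ x y → ¬ R x y)

  record Split (R : Rel V 0ℓ) (S : List V) : Set where
    constructor split
    field
      left right     : List V
      partition      : S ↭ left ++ right
      left-nonempty  : 1 ≤ length left
      right-nonempty : 1 ≤ length right
      joined         : Complete R left right ⊎ Anticomplete R left right

  split-complement : {R : Rel V 0ℓ} → (∀ {x y} → ¬ ¬ R x y → R x y) →
                     ∀ {S} → Split (λ x y → ¬ R x y) S → Split R S
  split-complement stable (split A B p nA nB (inj₁ comp)) = split A B p nA nB (inj₂ comp)
  split-complement stable (split A B p nA nB (inj₂ anti)) =
    split A B p nA nB (inj₁ λ a∈ b∈ → stable (anti a∈ b∈))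

module SplitStep {V : Set} (R : Rel V 0ℓ) (R? : Decidable₂ R) (R-sym : Symmetric R) (p4 : P4Free R) where

  -- v has a neighbour b in B and a non-neighbour x in A: the non-neighbours of v in A
  -- see no edge to the rest, since an edge q p with p a neighbour of v gives the P4 q p v b.
  split-∷-mixed : ∀ v {S} A B → S ↭ A ++ B → Anticomplete R A B →
                  ∀ {x b} → x ∈ A → ¬ R v x → b ∈ B → R v b → Split R (v ∷ S)
  split-∷-mixed v {S} A B p anti {x} {b} x∈A ¬vx b∈B vb =
    split (v ∷ N ++ B) M (prep v perm) (s≤s z≤n) (∈⇒1≤length (∈-filter⁺ (∁? (R? v)) x∈A ¬vx))
      (inj₂ separated)
    where
    N = filter (R? v) A
    M = filter (∁? (R? v)) A
    perm : S ↭ (N ++ B) ++ M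
    perm = begin
      S            ↭⟨ p ⟩
      A ++ B       ↭⟨ ++⁺ʳ B (filter-partition-↭ (R? v) A) ⟩
      (N ++ M) ++ B ↭⟨ ++-assoc N M B ⟩
      N ++ M ++ B  ↭⟨ ++⁺ˡ N (++-comm M B) ⟩
      N ++ B ++ M  ↭⟨ ++-assoc N B M ⟨
      (N ++ B) ++ M ∎
      where open PermutationReasoning
    separated : Anticomplete R (v ∷ N ++ B) M
    separated p∈ q∈M with ∈-filter⁻ (∁? (R? v)) {xs = A} q∈M
    separated (here refl) _ | _ , ¬vq = ¬vq
    separated (there p∈)  _ | q∈A , ¬vq with ∈-++⁻ N p∈
    ... | inj₂ p∈B = λ Rpq → anti q∈A p∈B (R-sym Rpq)
    ... | inj₁ p∈N with ∈-filter⁻ (R? v) {xs = A} p∈N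
    ...   | p∈A , vp = λ Rpq → p4 _ _ v b
            (R-sym Rpq , R-sym vp , vb , (λ Rqv → ¬vq (R-sym Rqv)) , anti p∈A b∈B , anti q∈A b∈B)

  split-∷ : ∀ v {S} A B → S ↭ A ++ B → 1 ≤ length A → 1 ≤ length B → Anticomplete R A B →
            Split R (v ∷ S)
  split-∷ v {S} A B p nA nB anti with any? (R? v) A
  ... | no ¬vA = split A (v ∷ B) (trans (prep v p) (↭-sym (shift v A B))) nA (s≤s z≤n) (inj₂ separated)
    where
    separated : Anticomplete R A (v ∷ B)
    separated a∈ (here refl) Rav = ¬vA (lose a∈ (R-sym Rav))
    separated a∈ (there b∈)  Rab = anti a∈ b∈ Rab
  ... | yes vA with find vA | any? (R? v) B
  ...   | _  , a∈A , va | no ¬vB = split (v ∷ A) B (prep v p) (s≤s z≤n) nB (inj₂ separated)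
    where
    separated : Anticomplete R (v ∷ A) B
    separated (here refl) b∈ Rvb = ¬vB (lose b∈ Rvb)
    separated (there a∈)  b∈ Rab = anti a∈ b∈ Rab
  ...   | _  , a∈A , va | yes vB with find vB | All.all? (R? v) S
  ...     | _ , b∈B , vb | yes vS =
    split (v ∷ []) S refl (s≤s z≤n) (subst (1 ≤_) (≡.sym (↭-length p)) (∈⇒1≤length (∈-++⁺ˡ a∈A)))
      (inj₁ λ { (here refl) s∈ → All.lookup vS s∈ })
  ...     | _ , b∈B , vb | no ¬vS with find (¬All⇒Any¬ (R? v) S ¬vS)
  ...       | x , x∈S , ¬vx with ∈-++⁻ A (∈-resp-↭ p x∈S)
  ...         | inj₁ x∈A = split-∷-mixed v A B p anti x∈A ¬vx b∈B vb
  ...         | inj₂ x∈B = split-∷-mixed v B A (trans p (++-comm A B))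
                             (λ b∈ a∈ Rba → anti a∈ b∈ (R-sym Rba)) x∈B ¬vx a∈A va

P4Free-complement : {V : Set} {R : Rel V 0ℓ} → (∀ {x y} → ¬ ¬ R x y → R x y) → Symmetric R →
                    P4Free R → P4Free (λ x y → ¬ R x y)
P4Free-complement stable R-sym p4 a b c d (¬ab , ¬bc , ¬cd , ¬¬ac , ¬¬bd , ¬¬ad) =
  p4 c a d b (R-sym (stable ¬¬ac) , stable ¬¬ad , R-sym (stable ¬¬bd) , ¬cd , ¬ab , λ Rcb → ¬bc (R-sym Rcb))

-- Adding the vertices one at a time; a complete split is an anticomplete split of the complement.
P4Free⇒split : {V : Set} {R : Rel V 0ℓ} → Decidable₂ R → Symmetric R → P4Free R →
               ∀ S → 2 ≤ length S → Split R S
P4Free⇒split R? R-sym p4 (x ∷ []) (s≤s ())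
P4Free⇒split R? R-sym p4 (x ∷ y ∷ []) _ with R? x y
... | yes Rxy = split (x ∷ []) (y ∷ []) refl (s≤s z≤n) (s≤s z≤n)
                (inj₁ λ { (here refl) (here refl) → Rxy })
... | no ¬Rxy = split (x ∷ []) (y ∷ []) refl (s≤s z≤n) (s≤s z≤n)
                (inj₂ λ { (here refl) (here refl) → ¬Rxy })
P4Free⇒split {R = R} R? R-sym p4 (v ∷ S@(_ ∷ _ ∷ _)) _
  with P4Free⇒split R? R-sym p4 S (s≤s (s≤s z≤n))
... | split A B p nA nB (inj₂ anti) = SplitStep.split-∷ R R? R-sym p4 v A B p nA nB anti
... | split A B p nA nB (inj₁ comp) = split-complement stable
        (SplitStep.split-∷ (λ x y → ¬ R x y) (λ x y → ¬? (R? x y)) (λ ¬Rxy Ryx → ¬Rxy (R-sym Ryx))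
          (P4Free-complement stable R-sym p4) v A B p nA nB λ a∈ b∈ ¬Rab → ¬Rab (comp a∈ b∈))
  where
  stable : ∀ {x y} → ¬ ¬ R x y → R x y
  stable = decidable-stable (R? _ _)

-- Clique packings

‖_‖ : List (List A) → ℕ
‖ xss ‖ = length (concat xss)

‖‖-++ : (xss yss : List (List A)) → ‖ xss ++ yss ‖ ≡ ‖ xss ‖ + ‖ yss ‖
‖‖-++ xss yss = ≡.trans (cong length (≡.sym (concat-++ xss yss))) (length-++ (concat xss))

‖‖-↭ : xss ↭ yss → ‖ xss ‖ ≡ ‖ yss ‖
‖‖-↭ p = ↭-length (concat-↭ p)

‖‖-filter-partition : {P : Pred A 0ℓ} (P? : Decidable P) (xss : List (List A)) →
                      ‖ xss ‖ ≡ ‖ map (filter P?) xss ‖ + ‖ map (filter (∁? P?)) xss ‖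
‖‖-filter-partition P? xss
  rewrite concat-map-filter P? xss | concat-map-filter (∁? P?) xss = length-filter-partition P? (concat xss)

‖‖-zip++ : (xss yss : List (List A)) → ‖ zip++ xss yss ‖ ≡ ‖ xss ‖ + ‖ yss ‖
‖‖-zip++ xss yss = ≡.trans (↭-length (concat-zip++ xss yss)) (length-++ (concat xss))

module _ {V : Set} (R : Rel V 0ℓ) where

  record IsMaximumClique (P : Pred V 0ℓ) (C : List V) : Set where
    constructor maximumClique
    field
      clique  : AllPairs R C
      inside  : All P C
      maximum : ∀ D → AllPairs R D → All P D → length D ≤ length C

  record Packing (P : Pred V 0ℓ) (Ys : List (List V)) : Set where
    constructor packing
    field
      cliques  : All (AllPairs R) Ys
      disjoint : Unique (concat Ys)
      inside   : All P (concat Ys)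

private variable
  V : Set
  R : Rel V 0ℓ
  P Q : Pred V 0ℓ

IsMaximumClique⇒nonempty : ∀ {C x} → IsMaximumClique R P C → P x → 1 ≤ length C
IsMaximumClique⇒nonempty (maximumClique _ _ max) Px = max (_ ∷ []) ([] ∷ []) (Px ∷ [])

Packing-map : (∀ {v} → P v → Q v) → ∀ {Ys} → Packing R P Ys → Packing R Q Ys
Packing-map f (packing cl u ins) = packing cl u (All.map f ins)

Packing-restrict : ∀ {Ys} → Packing R P Ys → All Q (concat Ys) → Packing R Q Ys
Packing-restrict (packing cl u _) ins = packing cl u ins

Packing-↭ : ∀ {Ys Ys′} → Ys ↭ Ys′ → Packing R P Ys → Packing R P Ys′
Packing-↭ p (packing cl u ins) =
  packing (All-resp-↭ p cl) (Unique-resp-↭ (concat-↭ p) u) (All-resp-↭ (concat-↭ p) ins)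

Packing-++⁻ : ∀ Xs {Ys} → Packing R P (Xs ++ Ys) → Packing R P Xs × Packing R P Ys
Packing-++⁻ {P = P} Xs {Ys} (packing cl u ins) =
  packing (All.++⁻ˡ Xs cl) (AllPairs-++⁻ˡ _ u′) (All.++⁻ˡ _ ins′) ,
  packing (All.++⁻ʳ Xs cl) (AllPairs-++⁻ʳ _ u′) (All.++⁻ʳ _ ins′)
  where
  split-concat = ≡.sym (concat-++ Xs Ys)
  u′   = subst Unique split-concat u
  ins′ = subst (All P) split-concat ins

Packing-filter : (Q? : Decidable Q) → ∀ {Ys} → Packing R P Ys → Packing R (λ v → P v × Q v) (map (filter Q?) Ys)
Packing-filter Q? {Ys} (packing cl u ins) = packing
  (All.map⁺ (All.map (AllPairs.filter⁺ Q?) cl))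
  (subst Unique (≡.sym (concat-map-filter Q? Ys)) (AllPairs.filter⁺ Q? u))
  (subst (All _) (≡.sym (concat-map-filter Q? Ys)) (All.zip (All.filter⁺ Q? ins , All.all-filter Q? (concat Ys))))

module _ (P∩Q=∅ : ∀ {v} → P v → Q v → ⊥) where

  private
    disjoint-++ : ∀ {Xs Ys} → Packing R P Xs → Packing R Q Ys → Unique (concat Xs ++ concat Ys)
    disjoint-++ (packing _ uX inX) (packing _ uY inY) =
      Unique.++⁺ uX uY λ (v∈X , v∈Y) → P∩Q=∅ (All.lookup inX v∈X) (All.lookup inY v∈Y)

    inside-++ : ∀ {Xs Ys} → Packing R P Xs → Packing R Q Ys → All (λ v → P v ⊎ Q v) (concat Xs ++ concat Ys)
    inside-++ (packing _ _ inX) (packing _ _ inY) = All.++⁺ (All.map inj₁ inX) (All.map inj₂ inY)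

  Packing-++ : ∀ {Xs Ys} → Packing R P Xs → Packing R Q Ys → Packing R (λ v → P v ⊎ Q v) (Xs ++ Ys)
  Packing-++ {Xs = Xs} {Ys} pX pY = packing
    (All.++⁺ (Packing.cliques pX) (Packing.cliques pY))
    (subst Unique (concat-++ Xs Ys) (disjoint-++ pX pY))
    (subst (All _) (concat-++ Xs Ys) (inside-++ pX pY))

  Packing-zip++ : (∀ {u v} → P u → Q v → R u v) →
                  ∀ {Xs Ys} → Packing R P Xs → Packing R Q Ys → Packing R (λ v → P v ⊎ Q v) (zip++ Xs Ys)
  Packing-zip++ {R = R} complete {Xs} {Ys} pX@(packing clX _ inX) pY@(packing clY _ inY) = packing
    (All-zip++ join ([] , []) ([] , []) (All.zip (clX , All.concat⁻ inX)) (All.zip (clY , All.concat⁻ inY)))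
    (Unique-resp-↭ (↭-sym (concat-zip++ Xs Ys)) (disjoint-++ pX pY))
    (All-resp-↭ (↭-sym (concat-zip++ Xs Ys)) (inside-++ pX pY))
    where
    join : ∀ {X Y} → AllPairs R X × All P X → AllPairs R Y × All Q Y → AllPairs R (X ++ Y)
    join (clX , inX) (clY , inY) =
      AllPairs.++⁺ clX clY (All.map (λ Pu → All.map (complete Pu) inY) inX)

-- The exchange lemma

module ExchangeLemma {V : Set} (_≟_ : DecidableEquality V) {R : Rel V 0ℓ}
  (R? : Decidable₂ R) (R-sym : Symmetric R) (p4 : P4Free R) where

  open import Data.List.Membership.DecPropositional _≟_ using (_∈?_)

  record Exchange (S C : List V) (Ys : List (List V)) (k : ℕ) : Set where
    constructor mkExchange
    field
      blocks  : List (List V)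
      few     : length blocks ≤ k
      packed  : Packing R (λ v → v ∈ S × v ∉ C) blocks
      bound   : ‖ Ys ‖ ≤ length C + ‖ blocks ‖

  ExchangeBelow : ℕ → Set
  ExchangeBelow m = ∀ {S C Ys k} → length S ≤ m → Unique S → IsMaximumClique R (_∈ S) C →
                    Packing R (_∈ S) Ys → length Ys ≡ suc k → Exchange S C Ys k

  module Parts {S A B : List V} (p : S ↭ A ++ B) (uS : Unique S) where

    A⊆S : ∀ {v} → v ∈ A → v ∈ S
    A⊆S v∈ = ∈-resp-↭ (↭-sym p) (∈-++⁺ˡ v∈)

    B⊆S : ∀ {v} → v ∈ B → v ∈ S
    B⊆S v∈ = ∈-resp-↭ (↭-sym p) (∈-++⁺ʳ A v∈)

    S⊆A∪B : ∀ {v} → v ∈ S → v ∈ A ⊎ v ∈ B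
    S⊆A∪B v∈ = ∈-++⁻ A (∈-resp-↭ p v∈)

    uA++B : Unique (A ++ B)
    uA++B = Unique-resp-↭ p uS

    A∩B=∅ : ∀ {v} → v ∈ A → v ∈ B → ⊥
    A∩B=∅ v∈A v∈B = Unique-++⇒Disjoint A uA++B (v∈A , v∈B)

    uA : Unique A
    uA = AllPairs-++⁻ˡ A uA++B

    uB : Unique B
    uB = AllPairs-++⁻ʳ A uA++B

    ∈S∉A⇒∈B : ∀ {v} → v ∈ S → v ∉ A → v ∈ B
    ∈S∉A⇒∈B v∈S v∉A with S⊆A∪B v∈S
    ... | inj₁ v∈A = ⊥-elim (v∉A v∈A)
    ... | inj₂ v∈B = v∈B

    clique⊆A : Anticomplete R A B → ∀ {X x} → AllPairs R X → All (_∈ S) X → x ∈ X → x ∈ A →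
               All (_∈ A) X
    clique⊆A anti {X} cX X⊆S x∈X x∈A = All.tabulate side
      where
      side : ∀ {w} → w ∈ X → w ∈ A
      side w∈X with S⊆A∪B (All.lookup X⊆S w∈X)
      ... | inj₁ w∈A = w∈A
      ... | inj₂ w∈B with AllPairs-∈ R-sym cX x∈X w∈X
      ...   | inj₁ refl = ⊥-elim (A∩B=∅ x∈A w∈B)
      ...   | inj₂ Rxw  = ⊥-elim (anti x∈A w∈B Rxw)

    clique⊈B⇒⊆A : Anticomplete R A B → ∀ {X} → AllPairs R X → All (_∈ S) X → ¬ All (_∈ B) X →
                  All (_∈ A) X
    clique⊈B⇒⊆A anti {X} cX X⊆S X⊈B with find (¬All⇒Any¬ (_∈? B) X X⊈B)
    ... | x , x∈X , x∉B with S⊆A∪B (All.lookup X⊆S x∈X)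
    ...   | inj₁ x∈A = clique⊆A anti cX X⊆S x∈X x∈A
    ...   | inj₂ x∈B = ⊥-elim (x∉B x∈B)

  exchange-small : ∀ {S C Ys k} → length S ≤ 1 → IsMaximumClique R (_∈ S) C → Packing R (_∈ S) Ys →
                   Exchange S C Ys k
  exchange-small {S} {C} {Ys} lS maxC (packing _ u ins) =
    mkExchange [] z≤n (packing [] [] []) (begin
      ‖ Ys ‖        ≤⟨ length-Unique-≤1 lS u ins ⟩
      length S      ≤⟨ S≤C S lS maxC ⟩
      length C      ≡⟨ +-identityʳ (length C) ⟨
      length C + 0  ∎)
    where
    open ≤-Reasoning
    S≤C : ∀ S → length S ≤ 1 → IsMaximumClique R (_∈ S) C → length S ≤ length C
    S≤C []           _        _    = z≤n
    S≤C (_ ∷ [])     _        maxC = IsMaximumClique⇒nonempty maxC (here refl)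
    S≤C (_ ∷ _ ∷ _)  (s≤s ())

  module CompleteSplit {S A B : List V} (p : S ↭ A ++ B) (uS : Unique S) (comp : Complete R A B)
    {C : List V} (maxC : IsMaximumClique R (_∈ S) C) where

    open Parts {A = A} {B} p uS
    open IsMaximumClique maxC renaming (clique to cC; inside to C⊆S; maximum to max)
    open ≤-Reasoning

    inA? : Decidable (_∈ A)
    inA? v = v ∈? A

    ∈S∉A⇒∈B′ : ∀ {v} → v ∈ S × v ∉ A → v ∈ B
    ∈S∉A⇒∈B′ (v∈S , v∉A) = ∈S∉A⇒∈B v∈S v∉A

    CA = filter inA? C
    CB = filter (∁? inA?) C

    |C| : length C ≡ length CA + length CB
    |C| = length-filter-partition inA? C

    CA⊆A : All (_∈ A) CA
    CA⊆A = All.all-filter inA? C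

    CB⊆B : All (_∈ B) CB
    CB⊆B = All.map ∈S∉A⇒∈B′ (All.zip (All.filter⁺ (∁? inA?) C⊆S , All.all-filter (∁? inA?) C))

    join-size : ∀ {X Y} → AllPairs R X → All (_∈ A) X → AllPairs R Y → All (_∈ B) Y →
                length X + length Y ≤ length CA + length CB
    join-size {X} {Y} cX X⊆A cY Y⊆B = begin
      length X + length Y    ≡⟨ length-++ X ⟨
      length (X ++ Y)        ≤⟨ max (X ++ Y) join (All.++⁺ (All.map A⊆S X⊆A) (All.map B⊆S Y⊆B)) ⟩
      length C               ≡⟨ |C| ⟩
      length CA + length CB  ∎
      where join = AllPairs.++⁺ cX cY (All.map (λ a∈ → All.map (comp a∈) Y⊆B) X⊆A)

    cCA : AllPairs R CA
    cCA = AllPairs.filter⁺ inA? cC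

    cCB : AllPairs R CB
    cCB = AllPairs.filter⁺ (∁? inA?) cC

    maxA : IsMaximumClique R (_∈ A) CA
    maxA = maximumClique cCA CA⊆A λ D cD D⊆A → +-cancelʳ-≤ (length CB) _ _ (join-size cD D⊆A cCB CB⊆B)

    maxB : IsMaximumClique R (_∈ B) CB
    maxB = maximumClique cCB CB⊆B λ D cD D⊆B → +-cancelˡ-≤ (length CA) _ _ (join-size cCA CA⊆A cD D⊆B)

  exchange-complete : ∀ {m} → ExchangeBelow m → ∀ {S A B} → S ↭ A ++ B → length A ≤ m → length B ≤ m →
    Unique S → Complete R A B → ∀ {C Ys k} → IsMaximumClique R (_∈ S) C → Packing R (_∈ S) Ys →
    length Ys ≡ suc k → Exchange S C Ys k
  exchange-complete ih {S} {A} {B} p lA lB uS comp {C} {Ys} {k} maxC pYs lYs =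
    mkExchange (zip++ ZA ZB) (length-zip++ ZA ZB fewA fewB)
      (Packing-map avoid (Packing-zip++ disjoint (λ u v → comp (proj₁ u) (proj₁ v)) packedA packedB))
      bound
    where
    open Parts {A = A} {B} p uS
    open CompleteSplit p uS comp maxC
    open ≤-Reasoning

    YsA = map (filter inA?) Ys
    YsB = map (filter (∁? inA?)) Ys

    |Ys| : ∀ f → length (map f Ys) ≡ suc k
    |Ys| f = ≡.trans (length-map f Ys) lYs

    open Exchange (ih lA uA maxA (Packing-map proj₂ (Packing-filter inA? pYs)) (|Ys| _))
      renaming (blocks to ZA; few to fewA; packed to packedA; bound to boundA)
    open Exchange (ih lB uB maxB (Packing-map ∈S∉A⇒∈B′ (Packing-filter (∁? inA?) pYs)) (|Ys| _))
      renaming (blocks to ZB; few to fewB; packed to packedB; bound to boundB)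

    disjoint : ∀ {v} → v ∈ A × v ∉ CA → v ∈ B × v ∉ CB → ⊥
    disjoint (v∈A , _) (v∈B , _) = A∩B=∅ v∈A v∈B

    avoid : ∀ {v} → (v ∈ A × v ∉ CA) ⊎ (v ∈ B × v ∉ CB) → v ∈ S × v ∉ C
    avoid (inj₁ (v∈A , v∉CA)) = A⊆S v∈A , λ v∈C → v∉CA (∈-filter⁺ inA? v∈C v∈A)
    avoid (inj₂ (v∈B , v∉CB)) =
      B⊆S v∈B , λ v∈C → v∉CB (∈-filter⁺ (∁? inA?) v∈C (λ v∈A → A∩B=∅ v∈A v∈B))

    bound : ‖ Ys ‖ ≤ length C + ‖ zip++ ZA ZB ‖
    bound = begin
      ‖ Ys ‖                                       ≡⟨ ‖‖-filter-partition inA? Ys ⟩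
      ‖ YsA ‖ + ‖ YsB ‖                            ≤⟨ +-mono-≤ boundA boundB ⟩
      (length CA + ‖ ZA ‖) + (length CB + ‖ ZB ‖)  ≡⟨ interchange (length CA) _ _ _ ⟩
      (length CA + length CB) + (‖ ZA ‖ + ‖ ZB ‖)  ≡⟨ cong₂ _+_ |C| (‖‖-zip++ ZA ZB) ⟨
      length C + ‖ zip++ ZA ZB ‖                   ∎

  exchange-sides : ∀ {m} → ExchangeBelow m → ∀ {S A B} → S ↭ A ++ B → length A ≤ m → Unique S →
    ∀ {C Ys k} → IsMaximumClique R (_∈ S) C → All (_∈ A) C →
    ∀ YsA YsB → Ys ↭ YsA ++ YsB → Packing R (_∈ A) YsA → Packing R (_∈ B) YsB →
    length Ys ≡ suc k → Exchange S C Ys k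
  exchange-sides ih p lA uS _ _ [] [] perm _ _ lYs with () ← ≡.trans (≡.sym lYs) (↭-length perm)
  exchange-sides ih {S} {A} {B} p lA uS {C} {Ys} (maximumClique _ _ max) C⊆A [] (Y ∷ YsB) perm _ pB lYs =
    mkExchange YsB (≤-reflexive (suc-injective (≡.trans (≡.sym (↭-length perm)) lYs)))
      (Packing-map outside (proj₂ (Packing-++⁻ (Y ∷ []) pB))) (begin
      ‖ Ys ‖                 ≡⟨ ≡.trans (‖‖-↭ perm) (length-++ Y) ⟩
      length Y + ‖ YsB ‖     ≤⟨ +-monoˡ-≤ (‖ YsB ‖) (max Y (All.head (Packing.cliques pB)) Y⊆S) ⟩
      length C + ‖ YsB ‖     ∎)
    where
    open Parts {A = A} {B} p uS
    open ≤-Reasoning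
    Y⊆S : All (_∈ S) Y
    Y⊆S = All.map B⊆S (All.++⁻ˡ Y (Packing.inside pB))
    outside : ∀ {v} → v ∈ B → v ∈ S × v ∉ C
    outside v∈B = B⊆S v∈B , λ v∈C → A∩B=∅ (All.lookup C⊆A v∈C) v∈B
  exchange-sides ih {S} {A} {B} p lA uS {C} {Ys} {k} (maximumClique cC _ max) C⊆A (Y ∷ YsA) YsB perm pA pB lYs =
    mkExchange (ZA ++ YsB) few (Packing-map avoid (Packing-++ disjoint packedA pB)) (begin
      ‖ Ys ‖                           ≡⟨ ≡.trans (‖‖-↭ perm) (‖‖-++ (Y ∷ YsA) YsB) ⟩
      ‖ Y ∷ YsA ‖ + ‖ YsB ‖            ≤⟨ +-monoˡ-≤ (‖ YsB ‖) boundA ⟩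
      (length C + ‖ ZA ‖) + ‖ YsB ‖    ≡⟨ +-assoc (length C) (‖ ZA ‖) (‖ YsB ‖) ⟩
      length C + (‖ ZA ‖ + ‖ YsB ‖)    ≡⟨ cong (length C +_) (‖‖-++ ZA YsB) ⟨
      length C + ‖ ZA ++ YsB ‖         ∎)
    where
    open Parts {A = A} {B} p uS
    open ≤-Reasoning
    maxA : IsMaximumClique R (_∈ A) C
    maxA = maximumClique cC C⊆A λ D cD D⊆A → max D cD (All.map A⊆S D⊆A)
    open Exchange (ih lA uA maxA pA refl)
      renaming (blocks to ZA; few to fewA; packed to packedA; bound to boundA)
    few : length (ZA ++ YsB) ≤ k
    few = ≤-pred (begin
      suc (length (ZA ++ YsB))           ≡⟨ cong suc (length-++ ZA) ⟩
      suc (length ZA + length YsB)       ≤⟨ s≤s (+-monoˡ-≤ (length YsB) fewA) ⟩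
      suc (length YsA + length YsB)      ≡⟨ cong suc (length-++ YsA) ⟨
      length ((Y ∷ YsA) ++ YsB)          ≡⟨ ↭-length perm ⟨
      length Ys                          ≡⟨ lYs ⟩
      suc k                              ∎)
    disjoint : ∀ {v} → v ∈ A × v ∉ C → v ∈ B → ⊥
    disjoint (v∈A , _) v∈B = A∩B=∅ v∈A v∈B
    avoid : ∀ {v} → (v ∈ A × v ∉ C) ⊎ v ∈ B → v ∈ S × v ∉ C
    avoid (inj₁ (v∈A , v∉C)) = A⊆S v∈A , v∉C
    avoid (inj₂ v∈B)         = B⊆S v∈B , λ v∈C → A∩B=∅ (All.lookup C⊆A v∈C) v∈B

  exchange-anticompleteˡ : ∀ {m} → ExchangeBelow m → ∀ {S A B} → S ↭ A ++ B → length A ≤ m → Unique S →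
    Anticomplete R A B → ∀ {C Ys k} → IsMaximumClique R (_∈ S) C → All (_∈ A) C → Packing R (_∈ S) Ys →
    length Ys ≡ suc k → Exchange S C Ys k
  exchange-anticompleteˡ ih {S} {A} {B} p lA uS anti {Ys = Ys} maxC C⊆A pYs lYs =
    exchange-sides ih p lA uS maxC C⊆A YsA YsB (trans perm (++-comm YsB YsA))
      (Packing-restrict pYsA (All.concat⁺ YsA⊆A))
      (Packing-restrict pYsB (All.concat⁺ (All.all-filter inB? Ys)))
      lYs
    where
    open Parts {A = A} {B} p uS
    inB? : Decidable (All (_∈ B))
    inB? = All.all? (_∈? B)
    YsB = filter inB? Ys
    YsA = filter (∁? inB?) Ys
    perm : Ys ↭ YsB ++ YsA
    perm = filter-partition-↭ inB? Ys
    pYsB = proj₁ (Packing-++⁻ YsB (Packing-↭ perm pYs))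
    pYsA = proj₂ (Packing-++⁻ YsB (Packing-↭ perm pYs))
    YsA⊆A : All (All (_∈ A)) YsA
    YsA⊆A = All.zipWith (λ (cY , Y⊆S , Y⊈B) → clique⊈B⇒⊆A anti cY Y⊆S Y⊈B)
      (Packing.cliques pYsA , All.zip (All.concat⁻ (Packing.inside pYsA) , All.all-filter (∁? inB?) Ys))

  exchange-anticomplete : ∀ {m} → ExchangeBelow m → ∀ {S A B} → S ↭ A ++ B → length A ≤ m → length B ≤ m →
    Unique S → Anticomplete R A B → ∀ {C Ys k} → IsMaximumClique R (_∈ S) C → 1 ≤ length C →
    Packing R (_∈ S) Ys → length Ys ≡ suc k → Exchange S C Ys k
  exchange-anticomplete ih {A = A} {B} p lA lB uS anti {C = c ∷ _} maxC@(maximumClique cC C⊆S _) _ pYs lYs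
    with Parts.S⊆A∪B p uS (All.head C⊆S)
  ... | inj₁ c∈A = exchange-anticompleteˡ ih p lA uS anti maxC
                     (Parts.clique⊆A p uS anti cC C⊆S (here refl) c∈A) pYs lYs
  ... | inj₂ c∈B = exchange-anticompleteˡ ih p′ lB uS anti′ maxC
                     (Parts.clique⊆A p′ uS anti′ cC C⊆S (here refl) c∈B) pYs lYs
    where
    p′ = trans p (++-comm A B)
    anti′ : Anticomplete R B A
    anti′ b∈ a∈ Rba = anti a∈ b∈ (R-sym Rba)

  exchange-below : ∀ m → ExchangeBelow m
  exchange-below _       {S = []}     _  _  maxC pYs _ = exchange-small z≤n maxC pYs
  exchange-below _       {S = _ ∷ []} _  _  maxC pYs _ = exchange-small ≤-refl maxC pYs
  exchange-below zero    {S = _ ∷ _ ∷ _} ()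
  exchange-below (suc m) {S = S@(_ ∷ _ ∷ _)} {C} {Ys} {k} lS uS maxC pYs lYs
    with P4Free⇒split R? R-sym p4 S (s≤s (s≤s z≤n))
  ... | split A B p nA nB joined = by-join joined
    where
    lA = split-smaller A B p lS nB
    lB = split-smaller B A (trans p (++-comm A B)) lS nA
    by-join : Complete R A B ⊎ Anticomplete R A B → Exchange S C Ys k
    by-join (inj₁ comp) = exchange-complete (exchange-below m) p lA lB uS comp maxC pYs lYs
    by-join (inj₂ anti) = exchange-anticomplete (exchange-below m) p lA lB uS anti maxC
                            (IsMaximumClique⇒nonempty maxC (here refl)) pYs lYs

  exchange : ∀ {S C Ys k} → Unique S → IsMaximumClique R (_∈ S) C → Packing R (_∈ S) Ys →
             length Ys ≡ suc k → Exchange S C Ys k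
  exchange = exchange-below _ ≤-refl

-- Greedy runs

module _ {m : ℕ} where

  elements : Subset m → List (Fin m)
  elements S = filter (_∈ₛ? S) (allFin m)

  elements-unique : ∀ S → Unique (elements S)
  elements-unique S = AllPairs.filter⁺ (_∈ₛ? S) (Unique.allFin⁺ m)

  ∈-elements⁺ : ∀ {S v} → v ∈ₛ S → v ∈ elements S
  ∈-elements⁺ {S} {v} v∈S = ∈-filter⁺ (_∈ₛ? S) (∈-allFin v) v∈S

  ∈-elements⁻ : ∀ {S v} → v ∈ elements S → v ∈ₛ S
  ∈-elements⁻ {S} v∈ = proj₂ (∈-filter⁻ (_∈ₛ? S) {xs = allFin m} v∈)

  ∈-listToSubset⁻ : ∀ {v} (X : List (Fin m)) → v ∈ₛ listToSubset X → v ∈ X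
  ∈-listToSubset⁻ []      v∈ = ⊥-elim (∉⊥ v∈)
  ∈-listToSubset⁻ (x ∷ X) v∈ with x∈p∪q⁻ ⁅ x ⁆ (listToSubset X) v∈
  ... | inj₁ v∈x = here (x∈⁅y⁆⇒x≡y x v∈x)
  ... | inj₂ v∈X = there (∈-listToSubset⁻ X v∈X)

  All-Empty : ∀ {S} {xs : List (Fin m)} → Empty S → All (_∈ₛ S) xs → xs ≡ []
  All-Empty {xs = []}    _     _          = refl
  All-Empty {xs = _ ∷ _} empty (v∈S ∷ _)  = ⊥-elim (empty (_ , v∈S))

greedy-bound : (G : Graph) → Cograph G → ∀ {S 𝒳} → GreedyRun G S 𝒳 →
               ∀ {Ys} → Packing (Adj G) (_∈ₛ S) Ys → ‖ Ys ‖ ≤ sum (take (length Ys) (map length 𝒳))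
greedy-bound G cg (stop empty) pYs = ≤-trans (≤-reflexive (cong length (All-Empty empty (Packing.inside pYs)))) z≤n
greedy-bound G cg (step _ _ _ _ _) {[]} _ = z≤n
greedy-bound G cg {S} (step {X = X} {𝒳 = 𝒳} _ cX X⊆S maxX run) {Y ∷ Ys} pYs = begin
  ‖ Y ∷ Ys ‖                                   ≤⟨ bound ⟩
  length X + ‖ Zs ‖                            ≤⟨ +-monoʳ-≤ (length X) (greedy-bound G cg run packedRest) ⟩
  length X + sum (take (length Zs) sizes)      ≤⟨ +-monoʳ-≤ (length X) (sum-take-mono few sizes) ⟩
  length X + sum (take (length Ys) sizes)      ∎
  where
  open ≤-Reasoning
  open ExchangeLemma Fin._≟_ (adj? G) (Graph.sym G) cg
  sizes = map length 𝒳
  maxX′ : IsMaximumClique (Adj G) (_∈ elements S) X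
  maxX′ = maximumClique cX (All.map ∈-elements⁺ X⊆S) λ D cD D⊆S → maxX D cD (All.map ∈-elements⁻ D⊆S)
  open Exchange (exchange (elements-unique S) maxX′ (Packing-map ∈-elements⁺ pYs) refl)
    renaming (blocks to Zs; packed to packedZs)
  remaining : ∀ {v} → v ∈ elements S × v ∉ X → v ∈ₛ S ─ listToSubset X
  remaining (v∈S , v∉X) = x∈p∧x∉q⇒x∈p─q (∈-elements⁻ v∈S) (λ v∈X → v∉X (∈-listToSubset⁻ X v∈X))
  packedRest = Packing-map remaining packedZs

CliquePartition⇒Packing : (G : Graph) → ∀ {𝒴} → IsCliquePartition G 𝒴 → Packing (Adj G) (_∈ₛ ⊤) 𝒴
CliquePartition⇒Packing G (blocks , perm) =
  packing (All.map proj₂ blocks) (Unique-resp-↭ (↭-sym perm) (Unique.allFin⁺ (n G))) (All.tabulate λ _ → ∈⊤)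

greedy-dominates : (G : Graph) → Cograph G → ∀ {𝒳 𝒴} → GreedyOutput G 𝒳 → IsCliquePartition G 𝒴 →
                   𝒴 ≼ 𝒳
greedy-dominates G cg {𝒳} {𝒴} run partition j with topSum-attained j 𝒴
... | Ys , _ , 𝒴↭ , |Ys|≤j , topSum≡ = begin
  sum (take j (sortedSizes 𝒴))            ≡⟨ sum-take-sortedSizes 𝒴 j ⟩
  topSum j (map length 𝒴)                 ≡⟨ ≡.trans (length-concat Ys) (≡.sym topSum≡) ⟨
  ‖ Ys ‖                                  ≤⟨ greedy-bound G cg run packedYs ⟩
  sum (take (length Ys) (map length 𝒳))   ≤⟨ sum-take-mono |Ys|≤j _ ⟩
  sum (take j (map length 𝒳))             ≤⟨ sum-take≤topSum j _ ⟩
  topSum j (map length 𝒳)                 ≡⟨ sum-take-sortedSizes 𝒳 j ⟨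
  sum (take j (sortedSizes 𝒳))            ∎
  where
  open ≤-Reasoning
  packedYs = proj₁ (Packing-++⁻ Ys (Packing-↭ 𝒴↭ (CliquePartition⇒Packing G partition)))

theorem9 : (G : Graph) → Cograph G →
    (𝒳 : List (List (Fin (n G)))) → GreedyOutput G 𝒳 →
    ¬ (Σ (List (List (Fin (n G)))) (λ 𝒴 →
         IsCliquePartition G 𝒴 × (𝒳 ≼ 𝒴) × ¬ (𝒴 ≼ 𝒳)))
theorem9 G cg 𝒳 run (𝒴 , partition , _ , 𝒴⋠𝒳) = 𝒴⋠𝒳 (greedy-dominates G cg run partition)
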